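{- Let $(G,\Gamma)$ be a Hecke pair, $R$ a commutative ring containing ${\mathbb Q}$, $V$ an $R[G]$-module, $q\ge 0$ and $g\in G$. Let $\Sigma'\subset\Sigma$ be two finite-index normal subgroups of $\Gamma$. Then $\Sigma'(g)\subset\Sigma(g)$ and $$\operatorname{res}^{\Sigma(g)}_{\Sigma'(g)}\circ T_{\Gamma g\Gamma}\=T_{\Gamma g\Gamma}\circ\operatorname{res}^{\Sigma}_{\Sigma'}$$ as maps $\bar H_q(\Sigma,V)\to\bar H_q(\Sigma'(g),V)$.
   Context: A Hecke pair $(G,\Gamma)$: $G$ a group, $\Gamma$ a subgroup with $\Gamma g\Gamma/\Gamma$ finite for all $g\in G$. For a subgroup $\Sigma$ of $G$, $I_\Sigma\subset R[\Sigma]$ is the augmentation ideal, $H_q^0(\Sigma,V)=\{v\in V: I_\Sigma^{q+1}v=0\}$ for $q\ge0$, $H_{ -1}^0(\Sigma,V)=0$, and $\bar H_q(\Sigma,V)=H_q^0(\Sigma,V)/H_{q-1}^0(\Sigma,V)$. For $\Sigma'\subset\Sigma$ one has $H_q^0(\Sigma,V)\subset H_q^0(\Sigma',V)$ for all $q$, which induces the restriction map $\operatorname{res}^\Sigma_{\Sigma'}:\bar H_q(\Sigma,V)\to\bar H_q(\Sigma',V)$. For a finite-index normal subgroup $\Sigma$ of $\Gamma$ and $g\in G$, $\Sigma(g)$ is the kernel of the action of $\Sigma$ by left multiplication on the finite set $\Gamma g\Gamma/\Sigma$; equivalently $\Sigma(g)=\bigcap_{\gamma\in\Gamma}\gamma(\Sigma\cap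 g\Sigma g^{ -1})\gamma^{ -1}$, a finite-index normal subgroup of $\Gamma$. The Hecke operator $T_{\Gamma g\Gamma}:\bar H_q(\Sigma,V)\to\bar H_q(\Sigma(g),V)$ is defined by writing $\Gamma g\Gamma=\dot\bigcup_j h_j\Sigma$ and setting $T_{\Gamma g\Gamma}[v]=\big[\frac1{[\Gamma:\Sigma]}\sum_j h_jv\big]$; this is well defined (independent of the representatives $h_j$ and of the representative $v$). -}

module Defs where

open import Level using (Level; _⊔_; Lift) renaming (suc to lsuc)
open import Algebra.Bundles using (Group; CommutativeRing)
open import Algebra.Module.Bundles using (Module)
open import Algebra.Morphism.Structures using (module RingMorphisms)
open import Data.Nat using (ℕ; zero; suc)
open import Data.Integer using (+_)
open import Data.Fin using (Fin)
open import Data.List using (List; []; _∷_; length; lookup; map; foldr)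
open import Data.Product using (_×_; ∃; ∃-syntax; _,_)
open import Relation.Unary using (Pred; _⊆_)
open import Relation.Binary.PropositionalEquality using (_≡_)
import Data.Rational as ℚ

module GroupNotions {a ℓ : Level} (G : Group a ℓ) where
  open Group G

  record IsSubgroup {p : Level} (P : Pred Carrier p) : Set (a ⊔ ℓ ⊔ p) where
    field
      resp : ∀ {x y} → x ≈ y → P x → P y
      ε∈   : P ε
      ∙∈   : ∀ {x y} → P x → P y → P (x ∙ y)
      ⁻¹∈  : ∀ {x} → P x → P (x ⁻¹)

  record IsNormalSubgroupOf {p q : Level} (Σ : Pred Carrier p) (Γ : Pred Carrier q)
         : Set (a ⊔ ℓ ⊔ p ⊔ q) where
    field
      subgroup : IsSubgroup Σ
      ⊆Γ       : Σ ⊆ Γ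
      conj∈    : ∀ {γ σ} → Γ γ → Σ σ → Σ (γ ∙ σ ∙ γ ⁻¹)

  DoubleCoset : {q : Level} → Pred Carrier q → Carrier → Pred Carrier (a ⊔ ℓ ⊔ q)
  DoubleCoset Γ g x = ∃[ γ₁ ] ∃[ γ₂ ] (Γ γ₁ × Γ γ₂ × x ≈ γ₁ ∙ g ∙ γ₂)

  -- hs = (h_1,…,h_n) is a list of representatives of A/S, i.e.
  -- A = h_1 S ∪̇ … ∪̇ h_n S  (x ∈ h S  ⇔  h⁻¹ x ∈ S)
  record IsLeftCosetReps {p q : Level} (A : Pred Carrier q) (S : Pred Carrier p)
         (hs : List Carrier) : Set (a ⊔ ℓ ⊔ p ⊔ q) where
    field
      inside   : ∀ (i : Fin (length hs)) {σ} → S σ → A (lookup hs i ∙ σ)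
      covering : ∀ {x} → A x → ∃[ i ] S (lookup hs i ⁻¹ ∙ x)
      disjoint : ∀ {x} (i j : Fin (length hs)) → A x →
                 S (lookup hs i ⁻¹ ∙ x) → S (lookup hs j ⁻¹ ∙ x) → i ≡ j

  HasFiniteIndexIn : {p q : Level} → Pred Carrier p → Pred Carrier q → Set (a ⊔ ℓ ⊔ p ⊔ q)
  HasFiniteIndexIn Σ Γ = ∃[ hs ] IsLeftCosetReps Γ Σ hs

  record IsHeckePair {q : Level} (Γ : Pred Carrier q) : Set (a ⊔ ℓ ⊔ q) where
    field
      subgroup : IsSubgroup Γ
      finite   : ∀ g → ∃[ hs ] IsLeftCosetReps (DoubleCoset Γ g) Γ hs

  -- Σ(g): kernel of the action of Σ by left multiplication on ΓgΓ/Σ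
  -- (σ x Σ = x Σ  ⇔  x⁻¹ σ x ∈ Σ)
  Kernel : {p q : Level} → Pred Carrier q → Pred Carrier p → Carrier →
           Pred Carrier (a ⊔ ℓ ⊔ p ⊔ q)
  Kernel Γ Σ g σ = Σ σ × (∀ {x} → DoubleCoset Γ g x → Σ (x ⁻¹ ∙ (σ ∙ x)))

-- R containing ℚ: a ring homomorphism ℚ → R

IsRingHomFromℚ : {r ℓr : Level} (R : CommutativeRing r ℓr) →
                 (ℚ.ℚ → CommutativeRing.Carrier R) → Set ℓr
IsRingHomFromℚ R φ =
  RingMorphisms.IsRingHomomorphism ℚ.+-*-rawRing (CommutativeRing.rawRing R) φ

module ModuleNotions {a ℓ r ℓr m ℓm : Level} (G : Group a ℓ)
       (R : CommutativeRing r ℓr) (M : Module R m ℓm) where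
  open Group G
  open CommutativeRing R using () renaming (Carrier to R₀; 0# to 0R)
  open Module M

  record IsRGModule (_▷_ : Carrier → Carrierᴹ → Carrierᴹ) : Set (a ⊔ ℓ ⊔ r ⊔ m ⊔ ℓm) where
    field
      ▷-cong : ∀ {x y v w} → x ≈ y → v ≈ᴹ w → (x ▷ v) ≈ᴹ (y ▷ w)
      ε-act  : ∀ v → (ε ▷ v) ≈ᴹ v
      ∙-act  : ∀ x y v → ((x ∙ y) ▷ v) ≈ᴹ (x ▷ (y ▷ v))
      +-act  : ∀ x v w → (x ▷ (v +ᴹ w)) ≈ᴹ ((x ▷ v) +ᴹ (x ▷ w))
      *-act  : ∀ x (s : R₀) v → (x ▷ (s *ₗ v)) ≈ᴹ (s *ₗ (x ▷ v))

  module WithAction (_▷_ : Carrier → Carrierᴹ → Carrierᴹ) where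

    _-ᴹ_ : Carrierᴹ → Carrierᴹ → Carrierᴹ
    v -ᴹ w = v +ᴹ (-ᴹ w)

    -- Ann n Σ v  ⇔  I_Σ^n v = 0, where I_Σ^n is spanned over R by the products
    -- (σ₁ - 1)⋯(σₙ - 1) with σᵢ ∈ Σ.
    Ann : {p : Level} → ℕ → Pred Carrier p → Pred Carrierᴹ (a ⊔ p ⊔ ℓm)
    Ann {p} zero    Σ v = Lift (a ⊔ p) (v ≈ᴹ 0ᴹ)
    Ann (suc n) Σ v = ∀ {σ} → Σ σ → Ann n Σ ((σ ▷ v) -ᴹ v)

    -- H_q^0(Σ,V) = { v : I_Σ^(q+1) v = 0 } ;  H_{q-1}^0(Σ,V) is then  Ann q Σ
    -- (in particular H_{-1}^0 = 0 = Ann 0 Σ).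
    H⁰ : {p : Level} → ℕ → Pred Carrier p → Pred Carrierᴹ (a ⊔ p ⊔ ℓm)
    H⁰ q Σ = Ann (suc q) Σ

    sumᴹ : List Carrierᴹ → Carrierᴹ
    sumᴹ = foldr _+ᴹ_ 0ᴹ

    -- 1 / (number of elements of a list), computed in R via φ.
    -- (The [] case never arises: a list of coset representatives of Γ/Σ
    --  is nonempty since ε ∈ Γ.)
    invLength : (ℚ.ℚ → R₀) → List Carrier → R₀
    invLength φ []       = 0R
    invLength φ (_ ∷ xs) = φ ((+ 1) ℚ./ suc (length xs))

    -- Hecke operator on representatives:
    --   T [v] = [ (1/[Γ:Σ]) Σ_j h_j v ]   where ΓgΓ = ∪̇ h_j Σ  (hs)
    --   and cs is a list of representatives of Γ/Σ (so [Γ:Σ] = length cs).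
    Hecke : (ℚ.ℚ → R₀) → (hs cs : List Carrier) → Carrierᴹ → Carrierᴹ
    Hecke φ hs cs v = invLength φ cs *ₗ sumᴹ (map (λ h → h ▷ v) hs)

{-# OPTIONS --safe #-}
-- Put a = 1/[Γ:Σ], a′ = 1/[Γ:Σ′] and F x = x ▷ v. Summing over a second set of coset
-- representatives supplies the missing index, so T[v] = a a′ ∑_{(i,l) ∈ hs × cs′} F hᵢ and
-- T′[v] = a a′ ∑_{(j,k) ∈ hs′ × cs} F h′ⱼ. The index sets are in bijection by
-- (h′ⱼΣ′, cₖΣ) ↦ (hᵢΣ, cₖσΣ′) where h′ⱼ = hᵢσ with σ ∈ Σ, whose inverse is built the same way
-- from (hᵢΣ, c′ₗΣ′). The difference thus becomes a sum of terms F hᵢ − F h′ⱼ = h′ⱼ ▷ (σ⁻¹ ▷ v − v);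
-- since I_Σ^{q+1} v = 0 and h′ⱼ⁻¹ Σ′(g) h′ⱼ ⊆ Σ′ ⊆ Σ, each of them is killed by I_{Σ′(g)}^q.
module Submission where

open import Level using (Level; lift)
open import Algebra.Bundles
  using (RawMonoid; Monoid; CommutativeMonoid; Group; AbelianGroup; CommutativeRing)
open import Algebra.Module.Bundles using (Module)
open import Algebra.Morphism.Structures using (module MonoidMorphisms; module RingMorphisms)
import Algebra.Definitions.RawMonoid as RawMonoidDefinitions
open import Data.Nat as ℕ using (ℕ; zero; suc)
open import Data.Fin using (Fin; zero; suc; _↑ˡ_; _↑ʳ_; combine; remQuot)
open import Data.Fin.Properties using (remQuot-combine; *↔×)
open import Data.Fin.Permutation using (Permutation; _⟨$⟩ʳ_)
open import Data.Product using (_×_; _,_; proj₁; proj₂; uncurry)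
open import Data.List using (List; []; _∷_; length; lookup; map)
open import Relation.Unary using (Pred; _⊆_)
open import Function using (_∘_; _↔_; Inverse; mk↔ₛ′)
open import Function.Construct.Composition using (_↔-∘_)
open import Function.Construct.Symmetry using (↔-sym)
open import Data.Integer as ℤ using (+_)
import Data.Integer.Properties as ℤ
open import Data.Integer.Tactic.RingSolver using (solve-∀)
open import Data.Rational as ℚ using (ℚ; 1ℚ)
import Data.Rational.Properties as ℚ
open import Data.Rational.Unnormalised as ℚᵘ using (mkℚᵘ; 1ℚᵘ; *≡*)
import Data.Rational.Unnormalised.Properties as ℚᵘ
open import Relation.Binary.PropositionalEquality as ≡ using (_≡_)
open import Defs
import Algebra.Properties.Monoid.Mult
import Algebra.Properties.Group
import Algebra.Properties.AbelianGroup
import Algebra.Properties.CommutativeSemigroup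
import Algebra.Properties.CommutativeMonoid.Sum
import Relation.Binary.Reasoning.Setoid

module _ {a₁ a₂ ℓ₁ ℓ₂ : Level} {M₁ : RawMonoid a₁ ℓ₁} (M₂ : Monoid a₂ ℓ₂)
         {f : RawMonoid.Carrier M₁ → Monoid.Carrier M₂}
         (f-hom : MonoidMorphisms.IsMonoidHomomorphism M₁ (Monoid.rawMonoid M₂) f) where
  open Monoid M₂
  open RawMonoidDefinitions M₁ using () renaming (_×_ to _×₁_)
  open RawMonoidDefinitions rawMonoid using () renaming (_×_ to _×₂_)
  open MonoidMorphisms.IsMonoidHomomorphism f-hom

  ×-homo : ∀ n x → f (n ×₁ x) ≈ n ×₂ f x
  ×-homo zero    x = ε-homo
  ×-homo (suc n) x = trans (homo x (n ×₁ x)) (∙-congˡ (×-homo n x))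

open RawMonoidDefinitions ℚᵘ.+-0-rawMonoid using () renaming (_×_ to _×ᵘ_)
open RawMonoidDefinitions ℚ.+-0-rawMonoid using () renaming (_×_ to _×ℚ_)

n×1≃n : ∀ n → n ×ᵘ 1ℚᵘ ℚᵘ.≃ mkℚᵘ (+ n) 0
n×1≃n zero    = *≡* ≡.refl
n×1≃n (suc n) = ℚᵘ.≃-trans (ℚᵘ.+-congʳ 1ℚᵘ (n×1≃n n)) (*≡* (≡.trans (ring-identity (+ n))
                  (≡.cong (ℤ._* (+ 1 ℤ.* + 1)) (≡.sym (ℤ.pos-+ 1 n)))))
  where
  ring-identity : ∀ x → (+ 1 ℤ.* + 1 ℤ.+ x ℤ.* + 1) ℤ.* + 1 ≡ (+ 1 ℤ.+ x) ℤ.* (+ 1 ℤ.* + 1)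
  ring-identity = solve-∀

1/[1+n]*[1+n]≡1 : ∀ n → (+ 1 ℚ./ suc n) ℚ.* (suc n ×ℚ 1ℚ) ≡ 1ℚ
1/[1+n]*[1+n]≡1 n = ℚ.toℚᵘ-injective (begin
  ℚ.toℚᵘ (1/[1+n] ℚ.* [1+n])
    ≈⟨ ℚ.toℚᵘ-homo-* 1/[1+n] [1+n] ⟩
  ℚ.toℚᵘ 1/[1+n] ℚᵘ.* ℚ.toℚᵘ [1+n]
    ≈⟨ ℚᵘ.*-cong (ℚ.toℚᵘ-fromℚᵘ (mkℚᵘ (+ 1) n)) [1+n]≃ ⟩
  ℚᵘ.1/ mkℚᵘ (+ suc n) 0 ℚᵘ.* mkℚᵘ (+ suc n) 0
    ≈⟨ ℚᵘ.*-inverseˡ (mkℚᵘ (+ suc n) 0) ⟩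
  1ℚᵘ ∎)
  where
  open ℚᵘ.≃-Reasoning
  1/[1+n] [1+n] : ℚ
  1/[1+n] = + 1 ℚ./ suc n
  [1+n]   = suc n ×ℚ 1ℚ
  [1+n]≃ : ℚ.toℚᵘ [1+n] ℚᵘ.≃ mkℚᵘ (+ suc n) 0
  [1+n]≃ = ℚᵘ.≃-trans (×-homo ℚᵘ.+-0-monoid ℚ.toℚᵘ-isMonoidHomomorphism-+ (suc n) 1ℚ)
                      (n×1≃n (suc n))

module _ {r ℓr : Level} (R : CommutativeRing r ℓr) {φ : ℚ → CommutativeRing.Carrier R}
         (φ-hom : IsRingHomFromℚ R φ) where
  open CommutativeRing R
  open Algebra.Properties.Monoid.Mult +-monoid using (×-congʳ) renaming (_×_ to _×ᴿ_)
  open RingMorphisms.IsRingHomomorphism φ-hom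

  φ-1/[1+n]*[1+n] : ∀ n → φ (+ 1 ℚ./ suc n) * (suc n ×ᴿ 1#) ≈ 1#
  φ-1/[1+n]*[1+n] n = begin
    φ (+ 1 ℚ./ suc n) * (suc n ×ᴿ 1#)         ≈⟨ *-congˡ [1+n]≈ ⟨
    φ (+ 1 ℚ./ suc n) * φ (suc n ×ℚ 1ℚ)       ≈⟨ *-homo _ _ ⟨
    φ ((+ 1 ℚ./ suc n) ℚ.* (suc n ×ℚ 1ℚ))     ≡⟨ ≡.cong φ (1/[1+n]*[1+n]≡1 n) ⟩
    φ 1ℚ                                      ≈⟨ 1#-homo ⟩
    1#                                        ∎
    where
    open Relation.Binary.Reasoning.Setoid setoid
    [1+n]≈ : φ (suc n ×ℚ 1ℚ) ≈ suc n ×ᴿ 1#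
    [1+n]≈ = trans (×-homo +-monoid +-isMonoidHomomorphism (suc n) 1ℚ)
                   (×-congʳ (suc n) 1#-homo)

module FinSum {c ℓ : Level} (M : CommutativeMonoid c ℓ) where
  open CommutativeMonoid M
  open Algebra.Properties.CommutativeMonoid.Sum M
  open Relation.Binary.Reasoning.Setoid setoid

  sum-↑ : ∀ m n (f : Fin (m ℕ.+ n) → Carrier) →
          sum f ≈ (∑[ i < m ] f (i ↑ˡ n)) ∙ (∑[ j < n ] f (m ↑ʳ j))
  sum-↑ zero    n f = sym (identityˡ _)
  sum-↑ (suc m) n f = trans (∙-congˡ (sum-↑ m n (f ∘ suc))) (sym (assoc _ _ _))

  sum-combine : ∀ m n (f : Fin (m ℕ.* n) → Carrier) →
                sum f ≈ ∑[ i < m ] ∑[ j < n ] f (combine i j)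
  sum-combine zero    n f = refl
  sum-combine (suc m) n f =
    trans (sum-↑ n (m ℕ.* n) f) (∙-congˡ (sum-combine m n (f ∘ (n ↑ʳ_))))

  ∑∑-reindex : ∀ {a b c d} (e : (Fin a × Fin b) ↔ (Fin c × Fin d))
               (f : Fin c → Fin d → Carrier) →
               ∑[ i < c ] ∑[ j < d ] f i j ≈
               ∑[ k < a ] ∑[ l < b ] uncurry f (Inverse.to e (k , l))
  ∑∑-reindex {a} {b} {c} {d} e f = begin
    ∑[ i < c ] ∑[ j < d ] f i j                  ≡⟨ sum-cong-≗ (λ i → sum-cong-≗ (λ j →
                                                      ≡.cong (uncurry f) (remQuot-combine i j))) ⟨
    ∑[ i < c ] ∑[ j < d ] F (combine i j)        ≈⟨ sum-combine c d F ⟨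
    sum F                                        ≈⟨ sum-permute F π ⟩
    sum (F ∘ (π ⟨$⟩ʳ_))                          ≈⟨ sum-combine a b (F ∘ (π ⟨$⟩ʳ_)) ⟩
    ∑[ k < a ] ∑[ l < b ] F (π ⟨$⟩ʳ combine k l) ≡⟨ sum-cong-≗ (λ k → sum-cong-≗ (λ l →
                                                      ≡.cong (uncurry f) (remQuot-π-combine k l))) ⟩
    ∑[ k < a ] ∑[ l < b ] uncurry f (Inverse.to e (k , l)) ∎
    where
    F : Fin (c ℕ.* d) → Carrier
    F = uncurry f ∘ remQuot d
    π : Permutation (a ℕ.* b) (c ℕ.* d)
    π = ↔-sym *↔× ↔-∘ (e ↔-∘ *↔×)
    remQuot-π-combine : ∀ k l → remQuot d (π ⟨$⟩ʳ combine k l) ≡ Inverse.to e (k , l)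
    remQuot-π-combine k l =
      ≡.trans (uncurry remQuot-combine (Inverse.to e (remQuot b (combine k l))))
              (≡.cong (Inverse.to e) (remQuot-combine k l))

module Cosets {a ℓ : Level} (G : Group a ℓ) where
  open Group G
  open GroupNotions G
  open Algebra.Properties.Group G using (\\-leftDividesˡ; ⁻¹-anti-homo-∙; ⁻¹-anti-homo-\\)
  open Relation.Binary.Reasoning.Setoid setoid

  module _ {p : Level} {S : Pred Carrier p} (S-sub : IsSubgroup S) where
    open IsSubgroup S-sub

    ∈-sym : ∀ {x y} → S (x ⁻¹ ∙ y) → S (y ⁻¹ ∙ x)
    ∈-sym {x} {y} t∈S = resp (⁻¹-anti-homo-\\ x y) (⁻¹∈ t∈S)

    ∈-cancel-∙ʳ : ∀ {s u c} → S s → S (u ⁻¹ ∙ (c ∙ s)) → S (c ⁻¹ ∙ u)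
    ∈-cancel-∙ʳ {s} {u} {c} s∈S t∈S = resp group-identity (∙∈ s∈S (⁻¹∈ t∈S))
      where
      group-identity : s ∙ (u ⁻¹ ∙ (c ∙ s)) ⁻¹ ≈ c ⁻¹ ∙ u
      group-identity = begin
        s ∙ (u ⁻¹ ∙ (c ∙ s)) ⁻¹  ≈⟨ ∙-congˡ (⁻¹-anti-homo-\\ u (c ∙ s)) ⟩
        s ∙ ((c ∙ s) ⁻¹ ∙ u)     ≈⟨ ∙-congˡ (∙-congʳ (⁻¹-anti-homo-∙ c s)) ⟩
        s ∙ ((s ⁻¹ ∙ c ⁻¹) ∙ u)  ≈⟨ ∙-congˡ (assoc _ _ _) ⟩
        s ∙ (s ⁻¹ ∙ (c ⁻¹ ∙ u))  ≈⟨ \\-leftDividesˡ s _ ⟩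
        c ⁻¹ ∙ u                 ∎

    ∈-reverse : ∀ {a b c d} → S (a ⁻¹ ∙ (b ∙ (c ⁻¹ ∙ d))) → S (d ⁻¹ ∙ (c ∙ (b ⁻¹ ∙ a)))
    ∈-reverse {a} {b} {c} {d} t∈S = resp group-identity (⁻¹∈ t∈S)
      where
      group-identity : (a ⁻¹ ∙ (b ∙ (c ⁻¹ ∙ d))) ⁻¹ ≈ d ⁻¹ ∙ (c ∙ (b ⁻¹ ∙ a))
      group-identity = begin
        (a ⁻¹ ∙ (b ∙ (c ⁻¹ ∙ d))) ⁻¹  ≈⟨ ⁻¹-anti-homo-\\ a _ ⟩
        (b ∙ (c ⁻¹ ∙ d)) ⁻¹ ∙ a       ≈⟨ ∙-congʳ (⁻¹-anti-homo-∙ b _) ⟩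
        ((c ⁻¹ ∙ d) ⁻¹ ∙ b ⁻¹) ∙ a    ≈⟨ ∙-congʳ (∙-congʳ (⁻¹-anti-homo-\\ c d)) ⟩
        ((d ⁻¹ ∙ c) ∙ b ⁻¹) ∙ a       ≈⟨ assoc _ _ _ ⟩
        (d ⁻¹ ∙ c) ∙ (b ⁻¹ ∙ a)       ≈⟨ assoc _ _ _ ⟩
        d ⁻¹ ∙ (c ∙ (b ⁻¹ ∙ a))       ∎

  DoubleCoset-resp : ∀ {q} {Γ : Pred Carrier q} {g x y} →
                     x ≈ y → DoubleCoset Γ g x → DoubleCoset Γ g y
  DoubleCoset-resp x≈y (γ₁ , γ₂ , γ₁∈Γ , γ₂∈Γ , x≈γ₁gγ₂) =
    γ₁ , γ₂ , γ₁∈Γ , γ₂∈Γ , trans (sym x≈y) x≈γ₁gγ₂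

  Kernel-mono : ∀ {p q} {Γ : Pred Carrier q} {S S′ : Pred Carrier p} {g} →
                S′ ⊆ S → Kernel Γ S′ g ⊆ Kernel Γ S g
  Kernel-mono S′⊆S (σ∈S′ , conj∈S′) = S′⊆S σ∈S′ , λ x∈ΓgΓ → S′⊆S (conj∈S′ x∈ΓgΓ)

  module LeftCosetReps {α p : Level} {A : Pred Carrier α} {S : Pred Carrier p}
                       {L : List Carrier} (reps : IsLeftCosetReps A S L) where
    open IsLeftCosetReps reps

    rep : Fin (length L) → Carrier
    rep = lookup L

    rep-∈ : (∀ {x y} → x ≈ y → A x → A y) → S ε → ∀ i → A (rep i)
    rep-∈ A-resp ε∈S i = A-resp (identityʳ _) (inside i ε∈S)

    index : ∀ {x} → A x → Fin (length L)
    index x∈A = proj₁ (covering x∈A)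

    index-∈ : ∀ {x} (x∈A : A x) → S (rep (index x∈A) ⁻¹ ∙ x)
    index-∈ x∈A = proj₂ (covering x∈A)

    index-unique : ∀ {x} (x∈A : A x) j → S (rep j ⁻¹ ∙ x) → index x∈A ≡ j
    index-unique x∈A j = disjoint (index x∈A) j x∈A (index-∈ x∈A)

  module CosetProduct
    {α γ p p′ : Level} {A : Pred Carrier α} {Γ : Pred Carrier γ}
    {S : Pred Carrier p} {S′ : Pred Carrier p′}
    (A-resp : ∀ {x y} → x ≈ y → A x → A y) (Γ-sub : IsSubgroup Γ)
    (S-sub : IsSubgroup S) (S′-sub : IsSubgroup S′) (S⊆Γ : S ⊆ Γ) (S′⊆S : S′ ⊆ S)
    {hs cs hs′ cs′ : List Carrier}
    (H : IsLeftCosetReps A S hs) (C : IsLeftCosetReps Γ S cs)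
    (H′ : IsLeftCosetReps A S′ hs′) (C′ : IsLeftCosetReps Γ S′ cs′) where

    private
      module H  = LeftCosetReps H
      module C  = LeftCosetReps C
      module H′ = LeftCosetReps H′
      module C′ = LeftCosetReps C′
      module Γ  = IsSubgroup Γ-sub
      module S  = IsSubgroup S-sub
      module S′ = IsSubgroup S′-sub

      h : Fin (length hs) → Carrier
      h = H.rep
      c : Fin (length cs) → Carrier
      c = C.rep
      h′ : Fin (length hs′) → Carrier
      h′ = H′.rep
      c′ : Fin (length cs′) → Carrier
      c′ = C′.rep

      h′∈A : ∀ j → A (h′ j)
      h′∈A = H′.rep-∈ A-resp S′.ε∈

      c′∈Γ : ∀ l → Γ (c′ l)
      c′∈Γ = C′.rep-∈ Γ.resp S′.ε∈

    project : Fin (length hs′) → Fin (length hs)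
    project j = H.index (h′∈A j)

    project-∈ : ∀ j → S (h′ j ⁻¹ ∙ h (project j))
    project-∈ j = ∈-sym S-sub (H.index-∈ (h′∈A j))

    private
      project′ : Fin (length cs′) → Fin (length cs)
      project′ l = C.index (c′∈Γ l)

      ck∙σ∈Γ : ∀ j k → Γ (c k ∙ (h (project j) ⁻¹ ∙ h′ j))
      ck∙σ∈Γ j k = Γ.∙∈ (C.rep-∈ Γ.resp S.ε∈ k) (S⊆Γ (H.index-∈ (h′∈A j)))

      hi∙σ∈A : ∀ i l → A (h i ∙ (c (project′ l) ⁻¹ ∙ c′ l))
      hi∙σ∈A i l = IsLeftCosetReps.inside H i (C.index-∈ (c′∈Γ l))

      to : Fin (length hs′) × Fin (length cs) → Fin (length hs) × Fin (length cs′)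
      to (j , k) = project j , C′.index (ck∙σ∈Γ j k)

      from : Fin (length hs) × Fin (length cs′) → Fin (length hs′) × Fin (length cs)
      from (i , l) = H′.index (hi∙σ∈A i l) , project′ l

      from∘to : ∀ x → from (to x) ≡ x
      from∘to (j , k) = ≡.cong₂ _,_ H′-index≡j project′-l≡k
        where
        l : Fin (length cs′)
        l = C′.index (ck∙σ∈Γ j k)
        τ∈S′ : S′ (c′ l ⁻¹ ∙ (c k ∙ (h (project j) ⁻¹ ∙ h′ j)))
        τ∈S′ = C′.index-∈ (ck∙σ∈Γ j k)
        project′-l≡k : project′ l ≡ k
        project′-l≡k = C.index-unique (c′∈Γ l) k
                         (∈-cancel-∙ʳ S-sub (H.index-∈ (h′∈A j)) (S′⊆S τ∈S′))
        H′-index≡j : H′.index (hi∙σ∈A (project j) l) ≡ j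
        H′-index≡j = H′.index-unique (hi∙σ∈A (project j) l) j
                       (≡.subst (λ k′ → S′ (h′ j ⁻¹ ∙ (h (project j) ∙ (c k′ ⁻¹ ∙ c′ l))))
                                (≡.sym project′-l≡k) (∈-reverse S′-sub τ∈S′))

      to∘from : ∀ y → to (from y) ≡ y
      to∘from (i , l) = ≡.cong₂ _,_ project-j≡i C′-index≡l
        where
        j : Fin (length hs′)
        j = H′.index (hi∙σ∈A i l)
        τ∈S′ : S′ (h′ j ⁻¹ ∙ (h i ∙ (c (project′ l) ⁻¹ ∙ c′ l)))
        τ∈S′ = H′.index-∈ (hi∙σ∈A i l)
        project-j≡i : project j ≡ i
        project-j≡i = H.index-unique (h′∈A j) i
                        (∈-cancel-∙ʳ S-sub (C.index-∈ (c′∈Γ l)) (S′⊆S τ∈S′))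
        C′-index≡l : C′.index (ck∙σ∈Γ j (project′ l)) ≡ l
        C′-index≡l = C′.index-unique (ck∙σ∈Γ j (project′ l)) l
                       (≡.subst (λ i′ → S′ (c′ l ⁻¹ ∙ (c (project′ l) ∙ (h i′ ⁻¹ ∙ h′ j))))
                                (≡.sym project-j≡i) (∈-reverse S′-sub τ∈S′))

    product-bijection : (Fin (length hs′) × Fin (length cs)) ↔
                        (Fin (length hs) × Fin (length cs′))
    product-bijection = mk↔ₛ′ to from to∘from from∘to

module AdditiveMaps {c ℓ : Level} (A : AbelianGroup c ℓ) where
  open AbelianGroup A
  open Group group using (_//_)
  open Algebra.Properties.AbelianGroup A using (⁻¹-∙-comm)
  open Algebra.Properties.Group group using (inverseʳ-unique; identityˡ-unique)
  open Algebra.Properties.CommutativeSemigroup commutativeSemigroup using (interchange)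

  //-interchange : ∀ a b c d → (a ∙ b) // (c ∙ d) ≈ (a // c) ∙ (b // d)
  //-interchange a b c d = trans (∙-congˡ (sym (⁻¹-∙-comm c d))) (interchange a b (c ⁻¹) (d ⁻¹))

  module _ {f : Carrier → Carrier} (f-cong : ∀ {x y} → x ≈ y → f x ≈ f y)
           (f-homo : ∀ x y → f (x ∙ y) ≈ f x ∙ f y) where

    ∙-homo⇒ε-homo : f ε ≈ ε
    ∙-homo⇒ε-homo = identityˡ-unique (f ε) (f ε)
                      (trans (sym (f-homo ε ε)) (f-cong (identityˡ ε)))

    ∙-homo⇒//-homo : ∀ x y → f (x // y) ≈ f x // f y
    ∙-homo⇒//-homo x y =
      trans (f-homo x (y ⁻¹)) (∙-congˡ (inverseʳ-unique (f y) (f (y ⁻¹)) f-inverse))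
      where
      f-inverse : f y ∙ f (y ⁻¹) ≈ ε
      f-inverse = trans (sym (f-homo y (y ⁻¹))) (trans (f-cong (inverseʳ y)) ∙-homo⇒ε-homo)

module ModuleSums {r ℓr m ℓm : Level} {R : CommutativeRing r ℓr} (M : Module R m ℓm) where
  open CommutativeRing R using (1#; _*_; _≈_; +-monoid)
  private module R = CommutativeRing R
  open Module M
  open Algebra.Properties.Monoid.Mult +-monoid using () renaming (_×_ to _×ᴿ_)
  open Algebra.Properties.Monoid.Mult +ᴹ-monoid using () renaming (_×_ to _×ᴹ_)
  open Algebra.Properties.CommutativeMonoid.Sum +ᴹ-commutativeMonoid

  *ₗ-distrib-sum : ∀ {n} s (f : Fin n → Carrierᴹ) → s *ₗ sum f ≈ᴹ ∑[ i < n ] (s *ₗ f i)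
  *ₗ-distrib-sum {zero}  s f = *ₗ-zeroʳ s
  *ₗ-distrib-sum {suc n} s f =
    ≈ᴹ-trans (*ₗ-distribˡ s _ _) (+ᴹ-congˡ (*ₗ-distrib-sum s (f ∘ suc)))

  ×ᴹ≈×ᴿ1#*ₗ : ∀ n x → n ×ᴹ x ≈ᴹ (n ×ᴿ 1#) *ₗ x
  ×ᴹ≈×ᴿ1#*ₗ zero    x = ≈ᴹ-sym (*ₗ-zeroˡ x)
  ×ᴹ≈×ᴿ1#*ₗ (suc n) x = ≈ᴹ-trans (+ᴹ-cong (≈ᴹ-sym (*ₗ-identityˡ x)) (×ᴹ≈×ᴿ1#*ₗ n x))
                                 (≈ᴹ-sym (*ₗ-distribʳ x 1# (n ×ᴿ 1#)))

  ∑∑-replicate : ∀ {m} n (f : Fin m → Carrierᴹ) →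
                 ∑[ i < m ] ∑[ j < n ] f i ≈ᴹ (n ×ᴿ 1#) *ₗ sum f
  ∑∑-replicate n f =
    ≈ᴹ-trans (sum-cong-≋ (λ i → ≈ᴹ-trans (sum-replicate n) (×ᴹ≈×ᴿ1#*ₗ n (f i))))
             (≈ᴹ-sym (*ₗ-distrib-sum (n ×ᴿ 1#) f))

  *ₗ-sum≈*ₗ-∑∑ : ∀ {m} n s t (f : Fin m → Carrierᴹ) → t * (n ×ᴿ 1#) ≈ 1# →
                 s *ₗ sum f ≈ᴹ (s * t) *ₗ ∑[ i < m ] ∑[ j < n ] f i
  *ₗ-sum≈*ₗ-∑∑ n s t f t*n≈1 = ≈ᴹ-sym (begin
    (s * t) *ₗ ∑[ i < _ ] ∑[ j < n ] f i  ≈⟨ *ₗ-congˡ (∑∑-replicate n f) ⟩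
    (s * t) *ₗ ((n ×ᴿ 1#) *ₗ sum f)       ≈⟨ *ₗ-assoc (s * t) (n ×ᴿ 1#) (sum f) ⟨
    ((s * t) * (n ×ᴿ 1#)) *ₗ sum f        ≈⟨ *ₗ-congʳ (R.trans (R.*-assoc s t _)
                                                               (R.*-congˡ t*n≈1)) ⟩
    (s * 1#) *ₗ sum f                     ≈⟨ *ₗ-congʳ (R.*-identityʳ s) ⟩
    s *ₗ sum f                            ∎)
    where open Relation.Binary.Reasoning.Setoid ≈ᴹ-setoid

module RGModule {a ℓ r ℓr m ℓm : Level} (G : Group a ℓ) (R : CommutativeRing r ℓr)
  (M : Module R m ℓm) (_▷_ : Group.Carrier G → Module.Carrierᴹ M → Module.Carrierᴹ M)
  (rg : ModuleNotions.IsRGModule G R M _▷_) where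
  open Group G
  open Module M
  open ModuleNotions.IsRGModule rg
  open ModuleNotions.WithAction G R M _▷_
  open AdditiveMaps +ᴹ-abelianGroup using (//-interchange; ∙-homo⇒ε-homo; ∙-homo⇒//-homo)
  open Algebra.Properties.Group G using (\\-leftDividesˡ)
  open Algebra.Properties.CommutativeMonoid.Sum +ᴹ-commutativeMonoid using (sum; sum-syntax)

  ▷-zeroʳ : ∀ x → (x ▷ 0ᴹ) ≈ᴹ 0ᴹ
  ▷-zeroʳ x = ∙-homo⇒ε-homo (▷-cong refl) (+-act x)

  ▷-distrib-sub : ∀ x v w → (x ▷ (v -ᴹ w)) ≈ᴹ ((x ▷ v) -ᴹ (x ▷ w))
  ▷-distrib-sub x = ∙-homo⇒//-homo (▷-cong refl) (+-act x)

  *ₗ-distrib-sub : ∀ s v w → (s *ₗ (v -ᴹ w)) ≈ᴹ ((s *ₗ v) -ᴹ (s *ₗ w))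
  *ₗ-distrib-sub s = ∙-homo⇒//-homo *ₗ-congˡ (*ₗ-distribˡ s)

  ▷-\\-sub : ∀ x z w → (x ▷ (((x ⁻¹ ∙ z) ▷ w) -ᴹ w)) ≈ᴹ ((z ▷ w) -ᴹ (x ▷ w))
  ▷-\\-sub x z w = ≈ᴹ-trans (▷-distrib-sub x _ w)
    (+ᴹ-congʳ (≈ᴹ-trans (≈ᴹ-sym (∙-act x (x ⁻¹ ∙ z) w)) (▷-cong (\\-leftDividesˡ x z) ≈ᴹ-refl)))

  module _ {p : Level} {S : Pred Carrier p} where

    Ann-resp : ∀ n {v w} → v ≈ᴹ w → Ann n S v → Ann n S w
    Ann-resp zero    v≈w (lift v≈0) = lift (≈ᴹ-trans (≈ᴹ-sym v≈w) v≈0)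
    Ann-resp (suc n) v≈w v∈Ann σ∈S =
      Ann-resp n (+ᴹ-cong (▷-cong refl v≈w) (-ᴹ‿cong v≈w)) (v∈Ann σ∈S)

    Ann-0 : ∀ n → Ann n S 0ᴹ
    Ann-0 zero          = lift ≈ᴹ-refl
    Ann-0 (suc n) {σ} _ =
      Ann-resp n (≈ᴹ-sym (≈ᴹ-trans (+ᴹ-congʳ (▷-zeroʳ σ)) (-ᴹ‿inverseʳ 0ᴹ))) (Ann-0 n)

    Ann-+ : ∀ n {v w} → Ann n S v → Ann n S w → Ann n S (v +ᴹ w)
    Ann-+ zero (lift v≈0) (lift w≈0) = lift (≈ᴹ-trans (+ᴹ-cong v≈0 w≈0) (+ᴹ-identityˡ 0ᴹ))
    Ann-+ (suc n) {v} {w} v∈Ann w∈Ann {σ} σ∈S = Ann-resp n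
      (≈ᴹ-trans (≈ᴹ-sym (//-interchange (σ ▷ v) (σ ▷ w) v w))
                (+ᴹ-congʳ (≈ᴹ-sym (+-act σ v w))))
      (Ann-+ n (v∈Ann σ∈S) (w∈Ann σ∈S))

    Ann-*ₗ : ∀ n s {v} → Ann n S v → Ann n S (s *ₗ v)
    Ann-*ₗ zero    s (lift v≈0) = lift (≈ᴹ-trans (*ₗ-congˡ v≈0) (*ₗ-zeroʳ s))
    Ann-*ₗ (suc n) s {v} v∈Ann {σ} σ∈S = Ann-resp n
      (≈ᴹ-trans (*ₗ-distrib-sub s (σ ▷ v) v) (+ᴹ-congʳ (≈ᴹ-sym (*-act σ s v))))
      (Ann-*ₗ n s (v∈Ann σ∈S))

    Ann-∑-sub : ∀ n {k} (f g : Fin k → Carrierᴹ) →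
                (∀ i → Ann n S (f i -ᴹ g i)) → Ann n S (sum f -ᴹ sum g)
    Ann-∑-sub n {zero}  f g _      = Ann-resp n (≈ᴹ-sym (-ᴹ‿inverseʳ 0ᴹ)) (Ann-0 n)
    Ann-∑-sub n {suc k} f g f-g∈Ann = Ann-resp n (≈ᴹ-sym (//-interchange _ _ _ _))
      (Ann-+ n (f-g∈Ann zero) (Ann-∑-sub n (f ∘ suc) (g ∘ suc) (f-g∈Ann ∘ suc)))

  Ann-▷ : ∀ {p t} {S : Pred Carrier p} {T : Pred Carrier t} x →
          (∀ {τ} → T τ → S (x ⁻¹ ∙ (τ ∙ x))) → ∀ n {w} → Ann n S w → Ann n T (x ▷ w)
  Ann-▷ x conj∈S zero    (lift w≈0) = lift (≈ᴹ-trans (▷-cong refl w≈0) (▷-zeroʳ x))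
  Ann-▷ x conj∈S (suc n) {w} w∈Ann {τ} τ∈T = Ann-resp n
    (≈ᴹ-trans (▷-\\-sub x (τ ∙ x) w) (+ᴹ-congʳ (∙-act τ x w)))
    (Ann-▷ x conj∈S n (w∈Ann (conj∈S τ∈T)))

  Ann-▷-sub-▷ : ∀ {p t} {S : Pred Carrier p} {T : Pred Carrier t} q {v x y} →
                H⁰ q S v → S (x ⁻¹ ∙ y) → (∀ {τ} → T τ → S (x ⁻¹ ∙ (τ ∙ x))) →
                Ann q T ((y ▷ v) -ᴹ (x ▷ v))
  Ann-▷-sub-▷ q {v} {x} {y} v∈H⁰ x⁻¹y∈S conj∈S =
    Ann-resp q (▷-\\-sub x y v) (Ann-▷ x conj∈S q (v∈H⁰ x⁻¹y∈S))

  sumᴹ-map : ∀ (F : Carrier → Carrierᴹ) (L : List Carrier) →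
             sumᴹ (map F L) ≡ sum (F ∘ lookup L)
  sumᴹ-map F []      = ≡.refl
  sumᴹ-map F (x ∷ L) = ≡.cong (F x +ᴹ_) (sumᴹ-map F L)

  module _ {φ : ℚ → CommutativeRing.Carrier R} (φ-hom : IsRingHomFromℚ R φ) where
    open CommutativeRing R using (_*_; 1#; +-monoid) renaming (_≈_ to _≈ᴿ_)
    open Algebra.Properties.Monoid.Mult +-monoid using () renaming (_×_ to _×ᴿ_)
    open ModuleSums M using (*ₗ-sum≈*ₗ-∑∑)
    open GroupNotions G
    open Cosets G
    open FinSum +ᴹ-commutativeMonoid using (∑∑-reindex)

    invLength-*-length : ∀ {p q} {Γ : Pred Carrier q} {S : Pred Carrier p} {cs} →
                         Γ ε → IsLeftCosetReps Γ S cs → invLength φ cs * (length cs ×ᴿ 1#) ≈ᴿ 1#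
    invLength-*-length {cs = []} ε∈Γ reps with IsLeftCosetReps.covering reps ε∈Γ
    ... | () , _
    invLength-*-length {cs = _ ∷ cs} _ _ = φ-1/[1+n]*[1+n] R φ-hom (length cs)

    Hecke≈∑∑ : ∀ {p q} {Γ : Pred Carrier q} {S : Pred Carrier p} {cs′} hs cs v →
               Γ ε → IsLeftCosetReps Γ S cs′ →
               Hecke φ hs cs v ≈ᴹ
               (invLength φ cs * invLength φ cs′) *ₗ
               ∑[ i < length hs ] ∑[ l < length cs′ ] (lookup hs i ▷ v)
    Hecke≈∑∑ {cs′ = cs′} hs cs v ε∈Γ reps =
      ≈ᴹ-trans (≈ᴹ-reflexive (≡.cong (invLength φ cs *ₗ_) (sumᴹ-map (_▷ v) hs)))
               (*ₗ-sum≈*ₗ-∑∑ (length cs′) (invLength φ cs) _ (λ i → lookup hs i ▷ v)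
                             (invLength-*-length ε∈Γ reps))

    module _ {p : Level} {Γ Σ Σ′ : Pred Carrier p} (Γ-sub : IsSubgroup Γ)
             (Σ-sub : IsSubgroup Σ) (Σ′-sub : IsSubgroup Σ′) (Σ⊆Γ : Σ ⊆ Γ) (Σ′⊆Σ : Σ′ ⊆ Σ)
             (g : Carrier) where

      Hecke-res-commute : ∀ q {hs cs hs′ cs′} →
        IsLeftCosetReps (DoubleCoset Γ g) Σ hs → IsLeftCosetReps Γ Σ cs →
        IsLeftCosetReps (DoubleCoset Γ g) Σ′ hs′ → IsLeftCosetReps Γ Σ′ cs′ →
        ∀ v → H⁰ q Σ v → Ann q (Kernel Γ Σ′ g) (Hecke φ hs cs v -ᴹ Hecke φ hs′ cs′ v)
      Hecke-res-commute q {hs} {cs} {hs′} {cs′} H C H′ C′ v v∈H⁰ =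
        Ann-resp q (≈ᴹ-sym Hecke-sub≈∑∑-sub) (Ann-*ₗ q (a₁ * a₂)
          (Ann-∑-sub q _ _ (λ j → Ann-∑-sub q {length cs} _ _ (λ _ → translate-sub-∈Ann j))))
        where
        open CosetProduct DoubleCoset-resp Γ-sub Σ-sub Σ′-sub Σ⊆Γ Σ′⊆Σ H C H′ C′
        open Relation.Binary.Reasoning.Setoid ≈ᴹ-setoid
        open CommutativeRing R using (*-comm)
        a₁ a₂ : CommutativeRing.Carrier R
        a₁ = invLength φ cs
        a₂ = invLength φ cs′
        h : Fin (length hs) → Carrier
        h  = lookup hs
        h′ : Fin (length hs′) → Carrier
        h′ = lookup hs′

        translate-sub-∈Ann : ∀ j → Ann q (Kernel Γ Σ′ g) ((h (project j) ▷ v) -ᴹ (h′ j ▷ v))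
        translate-sub-∈Ann j = Ann-▷-sub-▷ q v∈H⁰ (project-∈ j)
          (λ τ∈K → Σ′⊆Σ (proj₂ τ∈K (h′-∈ΓgΓ j)))
          where
          h′-∈ΓgΓ : ∀ j → DoubleCoset Γ g (h′ j)
          h′-∈ΓgΓ = LeftCosetReps.rep-∈ H′ DoubleCoset-resp (IsSubgroup.ε∈ Σ′-sub)

        Hecke-sub≈∑∑-sub : (Hecke φ hs cs v -ᴹ Hecke φ hs′ cs′ v) ≈ᴹ
                     ((a₁ * a₂) *ₗ ((∑[ j < length hs′ ] ∑[ k < length cs ] (h (project j) ▷ v))
                                   -ᴹ (∑[ j < length hs′ ] ∑[ k < length cs ] (h′ j ▷ v))))
        Hecke-sub≈∑∑-sub = begin
          Hecke φ hs cs v -ᴹ Hecke φ hs′ cs′ v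
            ≈⟨ +ᴹ-cong (Hecke≈∑∑ hs cs v (IsSubgroup.ε∈ Γ-sub) C′)
                       (-ᴹ‿cong (Hecke≈∑∑ hs′ cs′ v (IsSubgroup.ε∈ Γ-sub) C)) ⟩
          ((a₁ * a₂) *ₗ ∑[ i < length hs ] ∑[ l < length cs′ ] (h i ▷ v))
            -ᴹ ((a₂ * a₁) *ₗ ∑[ j < length hs′ ] ∑[ k < length cs ] (h′ j ▷ v))
            ≈⟨ +ᴹ-cong (*ₗ-congˡ (∑∑-reindex product-bijection (λ i _ → h i ▷ v)))
                       (-ᴹ‿cong (*ₗ-congʳ (*-comm a₂ a₁))) ⟩
          ((a₁ * a₂) *ₗ ∑[ j < length hs′ ] ∑[ k < length cs ] (h (project j) ▷ v))
            -ᴹ ((a₁ * a₂) *ₗ ∑[ j < length hs′ ] ∑[ k < length cs ] (h′ j ▷ v))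
            ≈⟨ *ₗ-distrib-sub (a₁ * a₂) _ _ ⟨
          (a₁ * a₂) *ₗ ((∑[ j < length hs′ ] ∑[ k < length cs ] (h (project j) ▷ v))
                        -ᴹ (∑[ j < length hs′ ] ∑[ k < length cs ] (h′ j ▷ v))) ∎

lemma1p2p3 : ∀ {a ℓ r ℓr m ℓm p} (G : Group a ℓ) →
    let open Group G using (Carrier) in
    let open GroupNotions G in
    (Γ : Pred Carrier p) → IsHeckePair Γ →
    (R : CommutativeRing r ℓr) (φ : ℚ → CommutativeRing.Carrier R) → IsRingHomFromℚ R φ →
    (M : Module R m ℓm) (_▷_ : Carrier → Module.Carrierᴹ M → Module.Carrierᴹ M) →
    ModuleNotions.IsRGModule G R M _▷_ →
    let open ModuleNotions.WithAction G R M _▷_ in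
    (q : ℕ) (g : Carrier) (Σ Σ′ : Pred Carrier p) →
    IsNormalSubgroupOf Σ Γ → HasFiniteIndexIn Σ Γ →
    IsNormalSubgroupOf Σ′ Γ → HasFiniteIndexIn Σ′ Γ →
    Σ′ ⊆ Σ →
    (Kernel Γ Σ′ g ⊆ Kernel Γ Σ g)
    ×
    ((hs cs hs′ cs′ : List Carrier) →
     IsLeftCosetReps (DoubleCoset Γ g) Σ hs → IsLeftCosetReps Γ Σ cs →
     IsLeftCosetReps (DoubleCoset Γ g) Σ′ hs′ → IsLeftCosetReps Γ Σ′ cs′ →
     ∀ v → H⁰ q Σ v →
     Ann q (Kernel Γ Σ′ g) (Hecke φ hs cs v -ᴹ Hecke φ hs′ cs′ v))
-- Normality and finite index are not used: the coset representatives are given explicitly.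
lemma1p2p3 G Γ Γ-Hecke R φ φ-hom M _▷_ rg q g Σ Σ′ Σ◁Γ _ Σ′◁Γ _ Σ′⊆Σ =
  Kernel-mono {S = Σ} Σ′⊆Σ ,
  λ _ _ _ _ → Hecke-res-commute φ-hom (IsHeckePair.subgroup Γ-Hecke)
                (subgroup Σ◁Γ) (subgroup Σ′◁Γ) (⊆Γ Σ◁Γ) Σ′⊆Σ g q
  where
  open GroupNotions G
  open IsNormalSubgroupOf using (subgroup; ⊆Γ)
  open Cosets G using (Kernel-mono)
  open RGModule G R M _▷_ rg using (Hecke-res-commute)
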